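{- Let $M$ be a matroid of rank $k$ on an $n$-element ground set $E$. Then, as rational functions, \[t_{M}(X,Y)=(X-1)^{ -(n-k)}X^{n}\,W_{M}\big(1,X^{ -1},(X-1)(Y-1)\big).\]
   Context: For a matroid $M$ on $E$ with rank function $r$, the nullity is $n_M(\sigma)=|\sigma|-r(\sigma)$. The Tutte polynomial is $t_M(X,Y)=\sum_{\sigma\subseteq E}(X-1)^{r(E)-r(\sigma)}(Y-1)^{|\sigma|-r(\sigma)}$. Generalized weight polynomials: $P_{M,0}(Z)=1$ and, for $1\le j\le n$, $P_{M,j}(Z)=(-1)^j\sum_{|\sigma|=j}\sum_{\gamma\subseteq\sigma}(-1)^{|\gamma|}Z^{n_M(\gamma)}$ (sums over subsets of $E$). The enumerator of $M$ is $W_M(X,Y,Z)=\sum_{i=0}^{n}P_{M,i}(Z)X^{n-i}Y^i$. -}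

module Defs where

open import Data.Nat as ℕ using (ℕ; zero; suc; _∸_; _≤_)
open import Data.Nat.Properties using (_≟_)
open import Data.Bool using (Bool; true; false)
open import Data.List using (List; []; _∷_; _++_; map; filter; foldr)
open import Data.Vec using (Vec; []; _∷_)
open import Data.Fin.Subset using (Subset; _⊆_; _∪_; _∩_; ∣_∣; ⊥; ⊤; inside; outside)
open import Data.Fin.Subset.Properties using (_⊆?_)
open import Data.Rational using (ℚ; 0ℚ; 1ℚ; _+_; _*_; -_; _-_)
open import Relation.Binary.PropositionalEquality using (_≡_)
open import Level using (0ℓ)

record Matroid (n : ℕ) : Set where
  field
    rank        : Subset n → ℕ
    rank-≤-card : ∀ A → rank A ≤ ∣ A ∣
    rank-mono   : ∀ {A B} → A ⊆ B → rank A ≤ rank B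
    rank-submod : ∀ A B → rank (A ∪ B) ℕ.+ rank (A ∩ B) ≤ rank A ℕ.+ rank B
open Matroid public

ground : ∀ {n} → Subset n
ground = ⊤

allSubsets : (n : ℕ) → List (Subset n)
allSubsets zero    = [] ∷ []
allSubsets (suc n) = map (outside ∷_) (allSubsets n) ++ map (inside ∷_) (allSubsets n)

subsetsOf : ∀ {n} → Subset n → List (Subset n)
subsetsOf {n} σ = filter (_⊆? σ) (allSubsets n)

subsetsOfSize : (n j : ℕ) → List (Subset n)
subsetsOfSize n j = filter (λ σ → ∣ σ ∣ ≟ j) (allSubsets n)

Σℚ : ∀ {A : Set} → List A → (A → ℚ) → ℚ
Σℚ xs f = foldr (λ a acc → f a + acc) 0ℚ xs

infixr 8 _^_
_^_ : ℚ → ℕ → ℚ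
x ^ zero  = 1ℚ
x ^ suc k = x * (x ^ k)

rankM : ∀ {n} → Matroid n → ℕ
rankM M = rank M ground

nullity : ∀ {n} → Matroid n → Subset n → ℕ
nullity M σ = ∣ σ ∣ ∸ rank M σ

tutte : ∀ {n} → Matroid n → ℚ → ℚ → ℚ
tutte {n} M x y =
  Σℚ (allSubsets n) λ σ →
    ((x - 1ℚ) ^ (rankM M ∸ rank M σ)) * ((y - 1ℚ) ^ nullity M σ)

P : ∀ {n} → Matroid n → ℕ → ℚ → ℚ
P M zero z = 1ℚ
P {n} M (suc j') z =
  ((- 1ℚ) ^ suc j') *
    Σℚ (subsetsOfSize n (suc j')) λ σ →
      Σℚ (subsetsOf σ) λ γ → ((- 1ℚ) ^ ∣ γ ∣) * (z ^ nullity M γ)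

upTo : ℕ → List ℕ
upTo zero    = zero ∷ []
upTo (suc m) = upTo m Data.List.∷ʳ suc m

W : ∀ {n} → Matroid n → ℚ → ℚ → ℚ → ℚ
W {n} M x y z = Σℚ (upTo n) λ i → P M i z * (x ^ (n ∸ i)) * (y ^ i)

module Submission where

-- Write u = 1/x, d = x - 1, z = d (y - 1) and g(γ) = (-1)^|γ| z^{n(γ)},
-- G(σ) = Σ_{γ ⊆ σ} g(γ), so that P_{M,i}(z) = (-1)^i Σ_{|σ| = i} G(σ)
-- (for i = 0 as well, since G(∅) = 1).
--
--  1. Grading by cardinality turns W_M(1, u, z) = Σ_i P_{M,i}(z) u^i into
--     Σ_σ (-u)^|σ| G(σ).
--  2. Exchanging the sums over γ ⊆ σ and using the binomial theorem for
--     supersets, Σ_{σ ⊇ γ} a^|σ| = a^|γ| (1 + a)^{n - |γ|}, gives the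
--     subset expansion W_M(1, u, z) = Σ_γ u^|γ| (1 - u)^{n - |γ|} z^{n(γ)}.
--     This holds for every matroid and all rationals u, z.
--  3. For u = 1/x each summand, multiplied by d^{-(n-k)} x^n, collapses to the
--     corresponding Tutte summand d^{k - r(γ)} (y - 1)^{n(γ)}.

open import Defs
open import Data.Nat as ℕ using (ℕ; zero; suc; _∸_; _≤_; z≤n; s≤s)
import Data.Nat.Properties as ℕP
open import Data.Bool using (Bool; true; false; if_then_else_)
open import Data.Sum using (inj₁; inj₂)
open import Data.List using (List; []; _∷_; _++_; map; filter; _∷ʳ_)
open import Data.Vec using ([]; _∷_)
open import Data.Vec.Properties using (∷-injectiveʳ)
open import Data.Fin.Subset using (Subset; ∣_∣; ⊥; ⊤; inside; outside)
open import Data.Fin.Subset.Properties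
  using (_⊆?_; ∣p∣≤n; ∣⊥∣≡0; ∣⊤∣≡n; ⊆-antisym; ⊥⊆; ⊆⊤)
open import Data.Rational using (ℚ; 0ℚ; 1ℚ; _+_; _*_; -_; _-_; 1/_; NonZero)
open import Data.Rational.Properties
open import Data.Rational.Solver using (module +-*-Solver)
open import Relation.Nullary using (yes; no; does; ¬_; contradiction)
open import Relation.Nullary.Decidable using (dec-true; dec-false)
open import Relation.Unary using (Pred; Decidable)
open import Level using (0ℓ)
open import Relation.Binary.PropositionalEquality
open ≡-Reasoning
open +-*-Solver

𝟙 : Bool → ℚ
𝟙 b = if b then 1ℚ else 0ℚ

Σ-++ : ∀ {A : Set} (xs ys : List A) f → Σℚ (xs ++ ys) f ≡ Σℚ xs f + Σℚ ys f
Σ-++ []       ys f = sym (+-identityˡ _)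
Σ-++ (x ∷ xs) ys f = trans (cong (f x +_) (Σ-++ xs ys f)) (sym (+-assoc (f x) _ _))

Σ-∷ʳ : ∀ {A : Set} (xs : List A) a f → Σℚ (xs ∷ʳ a) f ≡ Σℚ xs f + f a
Σ-∷ʳ xs a f = trans (Σ-++ xs (a ∷ []) f) (cong (Σℚ xs f +_) (+-identityʳ (f a)))

Σ-map : ∀ {A B : Set} (h : A → B) (xs : List A) f →
        Σℚ (map h xs) f ≡ Σℚ xs (λ a → f (h a))
Σ-map h []       f = refl
Σ-map h (x ∷ xs) f = cong (f (h x) +_) (Σ-map h xs f)

Σ-cong : ∀ {A : Set} (xs : List A) {f g : A → ℚ} → (∀ a → f a ≡ g a) → Σℚ xs f ≡ Σℚ xs g
Σ-cong []       eq = refl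
Σ-cong (x ∷ xs) eq = cong₂ _+_ (eq x) (Σ-cong xs eq)

Σ-0 : ∀ {A : Set} (xs : List A) → Σℚ xs (λ _ → 0ℚ) ≡ 0ℚ
Σ-0 []       = refl
Σ-0 (x ∷ xs) = trans (+-identityˡ _) (Σ-0 xs)

Σ-+ : ∀ {A : Set} (xs : List A) f g → Σℚ xs (λ a → f a + g a) ≡ Σℚ xs f + Σℚ xs g
Σ-+ []       f g = refl
Σ-+ (x ∷ xs) f g = trans (cong (f x + g x +_) (Σ-+ xs f g))
  (solve 4 (λ a b c d → (a :+ b) :+ (c :+ d) := (a :+ c) :+ (b :+ d)) refl
     (f x) (g x) (Σℚ xs f) (Σℚ xs g))

Σ-*ˡ : ∀ {A : Set} (xs : List A) c f → Σℚ xs (λ a → c * f a) ≡ c * Σℚ xs f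
Σ-*ˡ []       c f = sym (*-zeroʳ c)
Σ-*ˡ (x ∷ xs) c f = trans (cong (c * f x +_) (Σ-*ˡ xs c f)) (sym (*-distribˡ-+ c (f x) _))

Σ-*ʳ : ∀ {A : Set} (xs : List A) c f → Σℚ xs (λ a → f a * c) ≡ Σℚ xs f * c
Σ-*ʳ xs c f = trans (Σ-cong xs (λ a → *-comm (f a) c)) (trans (Σ-*ˡ xs c f) (*-comm c _))

Σ-swap : ∀ {A B : Set} (xs : List A) (ys : List B) (f : A → B → ℚ) →
         Σℚ xs (λ a → Σℚ ys (f a)) ≡ Σℚ ys (λ b → Σℚ xs (λ a → f a b))
Σ-swap []       ys f = sym (Σ-0 ys)
Σ-swap (x ∷ xs) ys f = trans (cong (Σℚ ys (f x) +_) (Σ-swap xs ys f))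
  (sym (Σ-+ ys (f x) (λ b → Σℚ xs (λ a → f a b))))

Σ-filter : ∀ {A : Set} {P : Pred A 0ℓ} (P? : Decidable P) (xs : List A) (f : A → ℚ) →
           Σℚ (filter P? xs) f ≡ Σℚ xs (λ a → 𝟙 (does (P? a)) * f a)
Σ-filter P? []       f = refl
Σ-filter P? (x ∷ xs) f with does (P? x)
... | true  = cong₂ _+_ (sym (*-identityˡ (f x))) (Σ-filter P? xs f)
... | false = trans (Σ-filter P? xs f) (sym (trans (cong (_+ _) (*-zeroˡ (f x))) (+-identityˡ _)))

δ-≢ : ∀ m i → ¬ m ≡ i → (c : ℚ) → 𝟙 (does (m ℕP.≟ i)) * c ≡ 0ℚ
δ-≢ m i m≢i c = trans (cong (λ b → 𝟙 b * c) (dec-false (m ℕP.≟ i) m≢i)) (*-zeroˡ c)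

δ-refl : ∀ m (c : ℚ) → 𝟙 (does (m ℕP.≟ m)) * c ≡ c
δ-refl m c = trans (cong (λ b → 𝟙 b * c) (dec-true (m ℕP.≟ m) refl)) (*-identityˡ c)

Σ-upTo-δ-beyond : ∀ n m → n ℕ.< m → (f : ℕ → ℚ) →
                  Σℚ (upTo n) (λ i → 𝟙 (does (m ℕP.≟ i)) * f i) ≡ 0ℚ
Σ-upTo-δ-beyond zero    m n<m f =
  trans (+-identityʳ _) (δ-≢ m 0 (λ { refl → ℕP.<-irrefl refl n<m }) (f 0))
Σ-upTo-δ-beyond (suc n) m n<m f = begin
  Σℚ (upTo (suc n)) (λ i → 𝟙 (does (m ℕP.≟ i)) * f i)
    ≡⟨ Σ-∷ʳ (upTo n) (suc n) (λ i → 𝟙 (does (m ℕP.≟ i)) * f i) ⟩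
  Σℚ (upTo n) (λ i → 𝟙 (does (m ℕP.≟ i)) * f i) + 𝟙 (does (m ℕP.≟ suc n)) * f (suc n)
    ≡⟨ cong₂ _+_ (Σ-upTo-δ-beyond n m (ℕP.<-trans (ℕP.n<1+n n) n<m) f)
                 (δ-≢ m (suc n) (λ { refl → ℕP.<-irrefl refl n<m }) (f (suc n))) ⟩
  0ℚ ∎

Σ-upTo-δ : ∀ n m → m ≤ n → (f : ℕ → ℚ) →
           Σℚ (upTo n) (λ i → 𝟙 (does (m ℕP.≟ i)) * f i) ≡ f m
Σ-upTo-δ zero    .zero z≤n f = trans (+-identityʳ _) (δ-refl 0 (f 0))
Σ-upTo-δ (suc n) m     m≤n f with ℕP.m≤n⇒m<n∨m≡n m≤n
... | inj₁ m<1+n = trans (Σ-∷ʳ (upTo n) (suc n) (λ i → 𝟙 (does (m ℕP.≟ i)) * f i))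
  (trans (cong₂ _+_ (Σ-upTo-δ n m (ℕP.≤-pred m<1+n) f)
                    (δ-≢ m (suc n) (λ { refl → ℕP.<-irrefl refl m<1+n }) (f (suc n))))
         (+-identityʳ _))
... | inj₂ refl = trans (Σ-∷ʳ (upTo n) (suc n) (λ i → 𝟙 (does (m ℕP.≟ i)) * f i))
  (trans (cong₂ _+_ (Σ-upTo-δ-beyond n (suc n) (ℕP.n<1+n n) f) (δ-refl (suc n) (f (suc n))))
         (+-identityˡ _))

Σall : ∀ n → (Subset n → ℚ) → ℚ
Σall n f = Σℚ (allSubsets n) f

Σall-suc : ∀ n f → Σall (suc n) f ≡ Σall n (λ σ → f (outside ∷ σ)) + Σall n (λ σ → f (inside ∷ σ))
Σall-suc n f = trans (Σ-++ (map (outside ∷_) (allSubsets n)) _ f)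
  (cong₂ _+_ (Σ-map (outside ∷_) (allSubsets n) f) (Σ-map (inside ∷_) (allSubsets n) f))

Σall-only-∅ : ∀ n {P : Pred (Subset n) 0ℓ} (P? : Decidable P) →
              (∀ σ → P σ → σ ≡ ⊥) → P ⊥ →
              (f : Subset n → ℚ) → Σall n (λ σ → 𝟙 (does (P? σ)) * f σ) ≡ f ⊥
Σall-only-∅ zero P? only p f with P? []
... | yes _  = trans (+-identityʳ _) (*-identityˡ _)
... | no ¬p  = contradiction p ¬p
Σall-only-∅ (suc n) P? only p f = trans (Σall-suc n (λ σ → 𝟙 (does (P? σ)) * f σ))
  (trans (cong₂ _+_ (Σall-only-∅ n (λ σ → P? (outside ∷ σ)) (λ σ q → ∷-injectiveʳ (only _ q)) p
                                  (λ σ → f (outside ∷ σ)))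
                    (trans (Σ-cong (allSubsets n) inside-term-vanishes) (Σ-0 (allSubsets n))))
         (+-identityʳ _))
  where
  inside-term-vanishes : ∀ σ → 𝟙 (does (P? (inside ∷ σ))) * f (inside ∷ σ) ≡ 0ℚ
  inside-term-vanishes σ with P? (inside ∷ σ)
  ... | yes q with only _ q
  ...   | ()
  inside-term-vanishes σ | no _ = *-zeroˡ (f (inside ∷ σ))

∣σ∣≡0⇒σ≡⊥ : ∀ {n} (σ : Subset n) → ∣ σ ∣ ≡ 0 → σ ≡ ⊥
∣σ∣≡0⇒σ≡⊥ []            e = refl
∣σ∣≡0⇒σ≡⊥ (outside ∷ σ) e = cong (outside ∷_) (∣σ∣≡0⇒σ≡⊥ σ e)
∣σ∣≡0⇒σ≡⊥ (inside ∷ σ)  ()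

Σ-by-cardinality : ∀ n (F : ℕ → Subset n → ℚ) →
  Σℚ (upTo n) (λ i → Σℚ (subsetsOfSize n i) (F i)) ≡ Σall n (λ σ → F ∣ σ ∣ σ)
Σ-by-cardinality n F = begin
  Σℚ (upTo n) (λ i → Σℚ (subsetsOfSize n i) (F i))
    ≡⟨ Σ-cong (upTo n) (λ i → Σ-filter (λ σ → ∣ σ ∣ ℕP.≟ i) (allSubsets n) (F i)) ⟩
  Σℚ (upTo n) (λ i → Σall n (λ σ → 𝟙 (does (∣ σ ∣ ℕP.≟ i)) * F i σ))
    ≡⟨ Σ-swap (upTo n) (allSubsets n) (λ i σ → 𝟙 (does (∣ σ ∣ ℕP.≟ i)) * F i σ) ⟩
  Σall n (λ σ → Σℚ (upTo n) (λ i → 𝟙 (does (∣ σ ∣ ℕP.≟ i)) * F i σ))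
    ≡⟨ Σ-cong (allSubsets n) (λ σ → Σ-upTo-δ n ∣ σ ∣ (∣p∣≤n σ) (λ i → F i σ)) ⟩
  Σall n (λ σ → F ∣ σ ∣ σ) ∎

^-+ : ∀ a m k → a ^ (m ℕ.+ k) ≡ a ^ m * a ^ k
^-+ a zero    k = sym (*-identityˡ _)
^-+ a (suc m) k = trans (cong (a *_) (^-+ a m k)) (sym (*-assoc a _ _))

^-* : ∀ a b k → (a * b) ^ k ≡ a ^ k * b ^ k
^-* a b zero    = refl
^-* a b (suc k) = trans (cong ((a * b) *_) (^-* a b k))
  (solve 4 (λ a b c d → (a :* b) :* (c :* d) := (a :* c) :* (b :* d)) refl a b (a ^ k) (b ^ k))

^-one : ∀ k → 1ℚ ^ k ≡ 1ℚ
^-one zero    = refl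
^-one (suc k) = trans (*-identityˡ _) (^-one k)

^-inverse : ∀ a b k → a * b ≡ 1ℚ → a ^ k * b ^ k ≡ 1ℚ
^-inverse a b k ab≡1 = trans (sym (^-* a b k)) (trans (cong (_^ k) ab≡1) (^-one k))

^-neg : ∀ a k → (- a) ^ k ≡ (- 1ℚ) ^ k * a ^ k
^-neg a k = trans (cong (_^ k) (solve 1 (λ a → :- a := :- con 1ℚ :* a) refl a)) (^-* (- 1ℚ) a k)

^-∸-split : ∀ e {a b c} → a ≤ b → b ≤ c → e ^ (b ∸ a) * e ^ (c ∸ b) ≡ e ^ (c ∸ a)
^-∸-split e {a} {b} {c} a≤b b≤c = trans (sym (^-+ e (b ∸ a) (c ∸ b))) (cong (e ^_) (∸-chain a≤b b≤c))
  where
  ∸-chain : ∀ {a b c} → a ≤ b → b ≤ c → (b ∸ a) ℕ.+ (c ∸ b) ≡ c ∸ a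
  ∸-chain {zero}          z≤n       b≤c       = ℕP.m+[n∸m]≡n b≤c
  ∸-chain {suc a} {suc b} {suc c} (s≤s a≤b) (s≤s b≤c) = ∸-chain a≤b b≤c

-- The binomial theorem for supersets

supersetWeight : ∀ {n} → Subset n → ℚ → ℚ
supersetWeight {n} γ a = Σall n (λ σ → a ^ ∣ σ ∣ * 𝟙 (does (γ ⊆? σ)))

Σ-factor : ∀ {A : Set} (xs : List A) a (f h : A → ℚ) →
           Σℚ xs (λ s → a * f s * h s) ≡ a * Σℚ xs (λ s → f s * h s)
Σ-factor xs a f h = trans (Σ-cong xs (λ s → *-assoc a (f s) (h s))) (Σ-*ˡ xs a _)

Σ-supersets : ∀ n (γ : Subset n) a → supersetWeight γ a ≡ a ^ ∣ γ ∣ * (1ℚ + a) ^ (n ∸ ∣ γ ∣)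
Σ-supersets zero    []            a = +-identityʳ _
Σ-supersets (suc n) (outside ∷ γ) a = begin
  supersetWeight (outside ∷ γ) a
    ≡⟨ Σall-suc n (λ σ → a ^ ∣ σ ∣ * 𝟙 (does (outside ∷ γ ⊆? σ))) ⟩
  supersetWeight γ a + Σall n (λ σ → a * a ^ ∣ σ ∣ * 𝟙 (does (γ ⊆? σ)))
    ≡⟨ cong (supersetWeight γ a +_) (Σ-factor (allSubsets n) a (λ σ → a ^ ∣ σ ∣) (λ σ → 𝟙 (does (γ ⊆? σ)))) ⟩
  supersetWeight γ a + a * supersetWeight γ a
    ≡⟨ cong (λ s → s + a * s) (Σ-supersets n γ a) ⟩
  a ^ ∣ γ ∣ * V + a * (a ^ ∣ γ ∣ * V)
    ≡⟨ solve 3 (λ a p v → p :* v :+ a :* (p :* v) := p :* ((con 1ℚ :+ a) :* v)) refl a (a ^ ∣ γ ∣) V ⟩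
  a ^ ∣ γ ∣ * (1ℚ + a) ^ suc (n ∸ ∣ γ ∣)
    ≡⟨ cong (λ e → a ^ ∣ γ ∣ * (1ℚ + a) ^ e) (sym (ℕP.+-∸-assoc 1 (∣p∣≤n γ))) ⟩
  a ^ ∣ γ ∣ * (1ℚ + a) ^ (suc n ∸ ∣ γ ∣) ∎
  where
    V : ℚ
    V = (1ℚ + a) ^ (n ∸ ∣ γ ∣)
Σ-supersets (suc n) (inside ∷ γ) a = begin
  supersetWeight (inside ∷ γ) a
    ≡⟨ Σall-suc n (λ σ → a ^ ∣ σ ∣ * 𝟙 (does (inside ∷ γ ⊆? σ))) ⟩
  Σall n (λ σ → a ^ ∣ σ ∣ * 0ℚ) + Σall n (λ σ → a * a ^ ∣ σ ∣ * 𝟙 (does (γ ⊆? σ)))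
    ≡⟨ cong₂ _+_ (trans (Σ-cong (allSubsets n) (λ σ → *-zeroʳ (a ^ ∣ σ ∣))) (Σ-0 (allSubsets n)))
                 (Σ-factor (allSubsets n) a (λ σ → a ^ ∣ σ ∣) (λ σ → 𝟙 (does (γ ⊆? σ)))) ⟩
  0ℚ + a * supersetWeight γ a
    ≡⟨ +-identityˡ _ ⟩
  a * supersetWeight γ a
    ≡⟨ cong (a *_) (Σ-supersets n γ a) ⟩
  a * (a ^ ∣ γ ∣ * (1ℚ + a) ^ (n ∸ ∣ γ ∣))
    ≡⟨ sym (*-assoc a _ _) ⟩
  a ^ ∣ inside ∷ γ ∣ * (1ℚ + a) ^ (suc n ∸ ∣ inside ∷ γ ∣) ∎

Σ-lower-sums : ∀ n a (g : Subset n → ℚ) →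
  Σall n (λ σ → a ^ ∣ σ ∣ * Σℚ (subsetsOf σ) g)
    ≡ Σall n (λ γ → a ^ ∣ γ ∣ * (1ℚ + a) ^ (n ∸ ∣ γ ∣) * g γ)
Σ-lower-sums n a g = begin
  Σall n (λ σ → a ^ ∣ σ ∣ * Σℚ (subsetsOf σ) g)
    ≡⟨ Σ-cong (allSubsets n) (λ σ → trans (cong (a ^ ∣ σ ∣ *_) (Σ-filter (_⊆? σ) (allSubsets n) g))
                                          (sym (Σ-*ˡ (allSubsets n) (a ^ ∣ σ ∣) (λ γ → 𝟙 (does (γ ⊆? σ)) * g γ)))) ⟩
  Σall n (λ σ → Σall n (λ γ → a ^ ∣ σ ∣ * (𝟙 (does (γ ⊆? σ)) * g γ)))
    ≡⟨ Σ-swap (allSubsets n) (allSubsets n) (λ σ γ → a ^ ∣ σ ∣ * (𝟙 (does (γ ⊆? σ)) * g γ)) ⟩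
  Σall n (λ γ → Σall n (λ σ → a ^ ∣ σ ∣ * (𝟙 (does (γ ⊆? σ)) * g γ)))
    ≡⟨ Σ-cong (allSubsets n) (λ γ → trans (Σ-cong (allSubsets n) (λ σ → sym (*-assoc (a ^ ∣ σ ∣) (𝟙 (does (γ ⊆? σ))) (g γ))))
                                          (Σ-*ʳ (allSubsets n) (g γ) (λ σ → a ^ ∣ σ ∣ * 𝟙 (does (γ ⊆? σ))))) ⟩
  Σall n (λ γ → supersetWeight γ a * g γ)
    ≡⟨ Σ-cong (allSubsets n) (λ γ → cong (_* g γ) (Σ-supersets n γ a)) ⟩
  Σall n (λ γ → a ^ ∣ γ ∣ * (1ℚ + a) ^ (n ∸ ∣ γ ∣) * g γ) ∎

-- The enumerator at X = 1 as a subset expansion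

module _ {n : ℕ} (M : Matroid n) (z : ℚ) where

  -- g(γ) = (-1)^|γ| z^{n(γ)} and G(σ) = Σ_{γ ⊆ σ} g(γ), the inner sums of P_{M,j}.
  signedNullityWeight : Subset n → ℚ
  signedNullityWeight γ = (- 1ℚ) ^ ∣ γ ∣ * z ^ nullity M γ

  lowerSum : Subset n → ℚ
  lowerSum σ = Σℚ (subsetsOf σ) signedNullityWeight

  -- G(∅) = 1: only γ = ∅ contributes, and it has nullity 0.
  lowerSum-∅ : lowerSum ⊥ ≡ 1ℚ
  lowerSum-∅ = begin
    lowerSum ⊥
      ≡⟨ Σ-filter (_⊆? ⊥) (allSubsets n) signedNullityWeight ⟩
    Σall n (λ γ → 𝟙 (does (γ ⊆? ⊥)) * signedNullityWeight γ)
      ≡⟨ Σall-only-∅ n (_⊆? ⊥) (λ γ γ⊆⊥ → ⊆-antisym γ⊆⊥ ⊥⊆) (λ p → p) signedNullityWeight ⟩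
    (- 1ℚ) ^ ∣ ⊥ {n} ∣ * z ^ (∣ ⊥ {n} ∣ ∸ rank M ⊥)
      ≡⟨ cong (λ e → (- 1ℚ) ^ e * z ^ (e ∸ rank M ⊥)) (∣⊥∣≡0 n) ⟩
    1ℚ * z ^ (0 ∸ rank M ⊥)
      ≡⟨ cong (λ e → 1ℚ * z ^ e) (ℕP.0∸n≡0 (rank M ⊥)) ⟩
    1ℚ * 1ℚ
      ≡⟨ *-identityˡ 1ℚ ⟩
    1ℚ ∎

  -- The defining clause of P_{M,j} for j ≥ 1 also holds for j = 0.
  P-as-layer-sum : ∀ i → P M i z ≡ (- 1ℚ) ^ i * Σℚ (subsetsOfSize n i) lowerSum
  P-as-layer-sum (suc i) = refl
  P-as-layer-sum zero    = sym (begin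
    1ℚ * Σℚ (subsetsOfSize n 0) lowerSum
      ≡⟨ *-identityˡ _ ⟩
    Σℚ (subsetsOfSize n 0) lowerSum
      ≡⟨ Σ-filter (λ σ → ∣ σ ∣ ℕP.≟ 0) (allSubsets n) lowerSum ⟩
    Σall n (λ σ → 𝟙 (does (∣ σ ∣ ℕP.≟ 0)) * lowerSum σ)
      ≡⟨ Σall-only-∅ n (λ σ → ∣ σ ∣ ℕP.≟ 0) ∣σ∣≡0⇒σ≡⊥ (∣⊥∣≡0 n) lowerSum ⟩
    lowerSum ⊥
      ≡⟨ lowerSum-∅ ⟩
    1ℚ ∎)

  W-as-lower-sums : ∀ u → W M 1ℚ u z ≡ Σall n (λ σ → (- u) ^ ∣ σ ∣ * lowerSum σ)
  W-as-lower-sums u = trans (Σ-cong (upTo n) layer) (Σ-by-cardinality n (λ i σ → (- u) ^ i * lowerSum σ))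
    where
    layer : ∀ i → P M i z * 1ℚ ^ (n ∸ i) * u ^ i ≡ Σℚ (subsetsOfSize n i) (λ σ → (- u) ^ i * lowerSum σ)
    layer i = begin
      P M i z * 1ℚ ^ (n ∸ i) * u ^ i
        ≡⟨ cong (λ p → p * 1ℚ ^ (n ∸ i) * u ^ i) (P-as-layer-sum i) ⟩
      (- 1ℚ) ^ i * S * 1ℚ ^ (n ∸ i) * u ^ i
        ≡⟨ cong (λ o → (- 1ℚ) ^ i * S * o * u ^ i) (^-one (n ∸ i)) ⟩
      (- 1ℚ) ^ i * S * 1ℚ * u ^ i
        ≡⟨ solve 3 (λ s m v → m :* s :* con 1ℚ :* v := (m :* v) :* s) refl S ((- 1ℚ) ^ i) (u ^ i) ⟩
      ((- 1ℚ) ^ i * u ^ i) * S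
        ≡⟨ cong (_* S) (sym (^-neg u i)) ⟩
      (- u) ^ i * S
        ≡⟨ sym (Σ-*ˡ (subsetsOfSize n i) ((- u) ^ i) lowerSum) ⟩
      Σℚ (subsetsOfSize n i) (λ σ → (- u) ^ i * lowerSum σ) ∎
      where
      S : ℚ
      S = Σℚ (subsetsOfSize n i) lowerSum

  W-subset-expansion : ∀ u →
    W M 1ℚ u z ≡ Σall n (λ γ → u ^ ∣ γ ∣ * (1ℚ - u) ^ (n ∸ ∣ γ ∣) * z ^ nullity M γ)
  W-subset-expansion u = begin
    W M 1ℚ u z
      ≡⟨ W-as-lower-sums u ⟩
    Σall n (λ σ → (- u) ^ ∣ σ ∣ * lowerSum σ)
      ≡⟨ Σ-lower-sums n (- u) signedNullityWeight ⟩
    Σall n (λ γ → (- u) ^ ∣ γ ∣ * (1ℚ - u) ^ (n ∸ ∣ γ ∣) * signedNullityWeight γ)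
      ≡⟨ Σ-cong (allSubsets n) signs-cancel ⟩
    Σall n (λ γ → u ^ ∣ γ ∣ * (1ℚ - u) ^ (n ∸ ∣ γ ∣) * z ^ nullity M γ) ∎
    where
    signs-cancel : ∀ γ → (- u) ^ ∣ γ ∣ * (1ℚ - u) ^ (n ∸ ∣ γ ∣) * signedNullityWeight γ
                         ≡ u ^ ∣ γ ∣ * (1ℚ - u) ^ (n ∸ ∣ γ ∣) * z ^ nullity M γ
    signs-cancel γ = begin
      (- u) ^ ∣ γ ∣ * V * ((- 1ℚ) ^ ∣ γ ∣ * Z)
        ≡⟨ cong (λ p → p * V * ((- 1ℚ) ^ ∣ γ ∣ * Z)) (^-neg u ∣ γ ∣) ⟩
      (- 1ℚ) ^ ∣ γ ∣ * u ^ ∣ γ ∣ * V * ((- 1ℚ) ^ ∣ γ ∣ * Z)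
        ≡⟨ solve 4 (λ s p v w → s :* p :* v :* (s :* w) := (s :* s) :* (p :* v :* w)) refl
                   ((- 1ℚ) ^ ∣ γ ∣) (u ^ ∣ γ ∣) V Z ⟩
      ((- 1ℚ) ^ ∣ γ ∣ * (- 1ℚ) ^ ∣ γ ∣) * (u ^ ∣ γ ∣ * V * Z)
        ≡⟨ cong (_* (u ^ ∣ γ ∣ * V * Z)) (^-inverse (- 1ℚ) (- 1ℚ) ∣ γ ∣ refl) ⟩
      1ℚ * (u ^ ∣ γ ∣ * V * Z)
        ≡⟨ *-identityˡ _ ⟩
      u ^ ∣ γ ∣ * V * Z ∎
      where
      V : ℚ
      V = (1ℚ - u) ^ (n ∸ ∣ γ ∣)
      Z : ℚ
      Z = z ^ nullity M γ

scaled-binomial-weight : ∀ x u {n g} → x * u ≡ 1ℚ → g ≤ n →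
  x ^ n * (u ^ g * (1ℚ - u) ^ (n ∸ g)) ≡ (x - 1ℚ) ^ (n ∸ g)
scaled-binomial-weight x u {n} {g} xu≡1 g≤n = begin
  x ^ n * (u ^ g * (1ℚ - u) ^ (n ∸ g))
    ≡⟨ cong (λ e → x ^ e * (u ^ g * (1ℚ - u) ^ (n ∸ g))) (sym (ℕP.m+[n∸m]≡n g≤n)) ⟩
  x ^ (g ℕ.+ (n ∸ g)) * (u ^ g * (1ℚ - u) ^ (n ∸ g))
    ≡⟨ cong (_* (u ^ g * (1ℚ - u) ^ (n ∸ g))) (^-+ x g (n ∸ g)) ⟩
  x ^ g * x ^ (n ∸ g) * (u ^ g * (1ℚ - u) ^ (n ∸ g))
    ≡⟨ solve 4 (λ a b c d → a :* b :* (c :* d) := a :* c :* (b :* d)) refl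
               (x ^ g) (x ^ (n ∸ g)) (u ^ g) ((1ℚ - u) ^ (n ∸ g)) ⟩
  x ^ g * u ^ g * (x ^ (n ∸ g) * (1ℚ - u) ^ (n ∸ g))
    ≡⟨ cong₂ _*_ (^-inverse x u g xu≡1) (sym (^-* x (1ℚ - u) (n ∸ g))) ⟩
  1ℚ * (x * (1ℚ - u)) ^ (n ∸ g)
    ≡⟨ *-identityˡ _ ⟩
  (x * (1ℚ - u)) ^ (n ∸ g)
    ≡⟨ cong (_^ (n ∸ g)) (trans (solve 2 (λ x u → x :* (con 1ℚ :- u) := x :- x :* u) refl x u)
                                (cong (λ w → x - w) xu≡1)) ⟩
  (x - 1ℚ) ^ (n ∸ g) ∎

summand-identity : ∀ x u e Y {n k g r} → x * u ≡ 1ℚ → e * (x - 1ℚ) ≡ 1ℚ →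
  r ≤ g → g ≤ n → r ≤ k → k ≤ n →
  e ^ (n ∸ k) * x ^ n * (u ^ g * (1ℚ - u) ^ (n ∸ g) * ((x - 1ℚ) * Y) ^ (g ∸ r))
    ≡ (x - 1ℚ) ^ (k ∸ r) * Y ^ (g ∸ r)
summand-identity x u e Y {n} {k} {g} {r} xu≡1 ed≡1 r≤g g≤n r≤k k≤n = begin
  e ^ (n ∸ k) * x ^ n * (u ^ g * (1ℚ - u) ^ (n ∸ g) * (d * Y) ^ (g ∸ r))
    ≡⟨ cong (λ p → e ^ (n ∸ k) * x ^ n * (u ^ g * (1ℚ - u) ^ (n ∸ g) * p)) (^-* d Y (g ∸ r)) ⟩
  e ^ (n ∸ k) * x ^ n * (u ^ g * (1ℚ - u) ^ (n ∸ g) * (d ^ (g ∸ r) * Y ^ (g ∸ r)))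
    ≡⟨ solve 6 (λ ε ξ μ ν δ η → ε :* ξ :* (μ :* ν :* (δ :* η)) := ε :* (ξ :* (μ :* ν)) :* δ :* η) refl
               (e ^ (n ∸ k)) (x ^ n) (u ^ g) ((1ℚ - u) ^ (n ∸ g)) (d ^ (g ∸ r)) (Y ^ (g ∸ r)) ⟩
  e ^ (n ∸ k) * (x ^ n * (u ^ g * (1ℚ - u) ^ (n ∸ g))) * d ^ (g ∸ r) * Y ^ (g ∸ r)
    ≡⟨ cong (λ p → e ^ (n ∸ k) * p * d ^ (g ∸ r) * Y ^ (g ∸ r)) (scaled-binomial-weight x u xu≡1 g≤n) ⟩
  e ^ (n ∸ k) * d ^ (n ∸ g) * d ^ (g ∸ r) * Y ^ (g ∸ r)
    ≡⟨ cong (_* Y ^ (g ∸ r)) (trans (*-assoc (e ^ (n ∸ k)) _ _)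
         (cong (e ^ (n ∸ k) *_) (trans (*-comm (d ^ (n ∸ g)) _) (^-∸-split d r≤g g≤n)))) ⟩
  e ^ (n ∸ k) * d ^ (n ∸ r) * Y ^ (g ∸ r)
    ≡⟨ cong (λ p → e ^ (n ∸ k) * p * Y ^ (g ∸ r)) (sym (trans (*-comm (d ^ (n ∸ k)) _) (^-∸-split d r≤k k≤n))) ⟩
  e ^ (n ∸ k) * (d ^ (n ∸ k) * d ^ (k ∸ r)) * Y ^ (g ∸ r)
    ≡⟨ cong (_* Y ^ (g ∸ r)) (trans (sym (*-assoc (e ^ (n ∸ k)) _ _))
         (trans (cong (_* d ^ (k ∸ r)) (^-inverse e d (n ∸ k) ed≡1)) (*-identityˡ (d ^ (k ∸ r))))) ⟩
  d ^ (k ∸ r) * Y ^ (g ∸ r) ∎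
  where
  d : ℚ
  d = x - 1ℚ

theorem4 : (n k : ℕ) (M : Matroid n) → rankM M ≡ k →
           (x y : ℚ) → (hx : NonZero x) → (hx1 : NonZero (x - 1ℚ)) →
           tutte M x y
             ≡ ((1/ (x - 1ℚ)) {{hx1}} ^ (n ∸ k)) * (x ^ n)
               * W M 1ℚ ((1/ x) {{hx}}) ((x - 1ℚ) * (y - 1ℚ))
theorem4 n k M rk≡k x y hx hx1 = sym (begin
  e ^ (n ∸ k) * x ^ n * W M 1ℚ u z
    ≡⟨ cong (e ^ (n ∸ k) * x ^ n *_) (W-subset-expansion M z u) ⟩
  e ^ (n ∸ k) * x ^ n * Σall n (λ γ → u ^ ∣ γ ∣ * (1ℚ - u) ^ (n ∸ ∣ γ ∣) * z ^ nullity M γ)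
    ≡⟨ sym (Σ-*ˡ (allSubsets n) (e ^ (n ∸ k) * x ^ n) _) ⟩
  Σall n (λ γ → e ^ (n ∸ k) * x ^ n * (u ^ ∣ γ ∣ * (1ℚ - u) ^ (n ∸ ∣ γ ∣) * z ^ nullity M γ))
    ≡⟨ Σ-cong (allSubsets n) summand ⟩
  Σall n (λ γ → d ^ (rankM M ∸ rank M γ) * (y - 1ℚ) ^ nullity M γ) ∎)
  where
  d : ℚ
  d = x - 1ℚ
  e : ℚ
  e = (1/ d) {{hx1}}
  u : ℚ
  u = (1/ x) {{hx}}
  z : ℚ
  z = d * (y - 1ℚ)
  k≤n : k ≤ n
  k≤n = subst₂ _≤_ rk≡k (∣⊤∣≡n n) (rank-≤-card M ⊤)
  summand : ∀ γ → e ^ (n ∸ k) * x ^ n * (u ^ ∣ γ ∣ * (1ℚ - u) ^ (n ∸ ∣ γ ∣) * z ^ nullity M γ)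
                  ≡ d ^ (rankM M ∸ rank M γ) * (y - 1ℚ) ^ nullity M γ
  summand γ = trans
    (summand-identity x u e (y - 1ℚ) (*-inverseʳ x {{hx}}) (*-inverseˡ d {{hx1}})
       (rank-≤-card M γ) (∣p∣≤n γ) (subst (rank M γ ≤_) rk≡k (rank-mono M ⊆⊤)) k≤n)
    (cong (λ r → d ^ (r ∸ rank M γ) * (y - 1ℚ) ^ nullity M γ) (sym rk≡k))
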